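{- Let $d\in\mathbb{Z}^+$ and $0<\alpha<1$, and let $G$ be a $d$-regular graph on an $n$-element vertex set $M$ such that for each $S\subseteq M$ with $|S|\le n/2$, at least $\alpha d|S|$ edges of $G$ have one endpoint in $S$ and the other in $M\setminus S$. Then there is a constant $c$ depending only on $\alpha$ such that for each nonempty $U\subseteq M$ with $|U|\le n/2$, $$\sum_{x\in U} d_G(x,M\setminus U)\le c\,|U|.$$
   Context: $d_G$ is the shortest-path distance in the undirected graph $G$, and $d_G(x,T)=\min_{t\in T}d_G(x,t)$ for a set $T$ of vertices. The paper states the conclusion as $O(|U|)$.
   Formalization: The parameter α is a rational number with $0<\alpha<1$. -}

module Defs where

open import Data.Bool using (Bool; true; false; _∧_; _∨_; not; if_then_else_)
open import Data.Nat using (ℕ; zero; suc; _+_)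
open import Data.Fin using (Fin)
open import Data.List using (List; map; allFin)
open import Data.Bool.ListAction using (any)
open import Data.Nat.ListAction using (sum)
open import Data.Fin using (_≟_)
open import Relation.Nullary.Decidable.Core using (does)
open import Data.Vec using (lookup)
open import Data.Fin.Subset using (Subset)
open import Relation.Binary.PropositionalEquality using (_≡_)

record Graph (n : ℕ) : Set where
  field
    adj       : Fin n → Fin n → Bool
    adj-sym   : ∀ x y → adj x y ≡ adj y x
    adj-irrefl : ∀ x → adj x x ≡ false
open Graph public

count : ∀ {n} → (Fin n → Bool) → ℕ
count {n} P = sum (map (λ x → if P x then 1 else 0) (allFin n))

sumOver : ∀ {n} → Subset n → (Fin n → ℕ) → ℕ
sumOver {n} U f = sum (map (λ x → if lookup U x then f x else 0) (allFin n))

degree : ∀ {n} → Graph n → Fin n → ℕ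
degree G x = count (adj G x)

Regular : ∀ {n} → ℕ → Graph n → Set
Regular d G = ∀ x → degree G x ≡ d

-- number of edges with one endpoint in S and the other in M \ S
-- (each such edge counted once, as the ordered pair (x ∈ S, y ∉ S))
edgeBoundary : ∀ {n} → Graph n → Subset n → ℕ
edgeBoundary {n} G S =
  sum (map (λ x → if lookup S x then count (λ y → not (lookup S y) ∧ adj G x y) else 0) (allFin n))

reach : ∀ {n} → Graph n → ℕ → Fin n → Fin n → Bool
reach {n} G zero x y = does (x ≟ y)
reach {n} G (suc k) x y = reach G k x y ∨ any (λ z → reach G k x z ∧ adj G z y) (allFin n)

search : (ℕ → Bool) → ℕ → ℕ → ℕ
search P zero k = k
search P (suc f) k = if P k then k else search P f (suc k)

-- Distances in an n-vertex graph are < n; the value n encodes "unreachable"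
-- (never occurs under the theorem's hypotheses, which force connectivity).
distToSet : ∀ {n} → Graph n → Fin n → Subset n → ℕ
distToSet {n} G x T = search (λ k → any (λ y → lookup T y ∧ reach G k x y) (allFin n)) n 0

{-# OPTIONS --safe #-}
-- Let F_k be the set of vertices at distance more than k from M ∖ U, so F_0 ⊆ U and the sum of
-- the distances over U is Σ_k |F_k|. Every edge leaving F_{k+1} ends in the shell F_k ∖ F_{k+1},
-- so d-regularity and expansion of F_{k+1} ⊆ U give α d |F_{k+1}| ≤ d |F_k ∖ F_{k+1}|. For an
-- integer K ≥ 1/α this reads (K + 1) |F_{k+1}| ≤ K |F_k|, and the geometric decay bounds the sum
-- by (K + 1) |U|.
module Submission where

open import Defs
open import Data.Nat using (ℕ; _≤_; _*_; NonZero)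
open import Data.Integer using (+_)
open import Data.Rational using (ℚ; _/_; _<_; 0ℚ; 1ℚ)
open import Data.Product using (Σ; ∃)
open import Data.Product using (_,_)
open import Data.Fin.Subset using (Subset; ∣_∣; Nonempty; ∁)
import Data.Rational as Q

open import Algebra.Properties.CommutativeSemigroup using (interchange; x∙yz≈y∙xz)
open import Data.Bool using (Bool; true; false; T; _∧_; not; if_then_else_)
open import Data.Bool.ListAction using (any)
open import Data.Bool.Properties using (T-∧; T-∨)
open import Data.Empty using (⊥-elim)
open import Data.Fin using (Fin; _≟_)
import Data.Fin as Fin
import Data.Integer as ℤ
import Data.Integer.Properties as ℤ
open import Data.List using ([]; _∷_; map; allFin)
open import Data.List.Membership.Propositional using (lose)
open import Data.List.Membership.Propositional.Properties using (∈-allFin)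
open import Data.List.Properties using (map-cong; map-tabulate)
import Data.List.Relation.Unary.Any as Any
open import Data.List.Relation.Unary.Any.Properties using (any⁺; any⁻)
open import Data.Nat using (zero; suc; _+_; z≤n)
open import Data.Nat.ListAction using (sum)
open import Data.Nat.Properties
  using (≤-refl; ≤-trans; ≤-reflexive; +-mono-≤; +-monoˡ-≤; +-monoʳ-≤; *-monoʳ-≤;
         *-cancelˡ-≤; m≤m+n;
         +-identityʳ; +-suc; *-comm; *-zeroʳ; *-identityʳ; *-distribˡ-+;
         +-commutativeSemigroup; *-commutativeSemigroup; module ≤-Reasoning)
import Data.Nat.Coprimality as Coprime
import Data.Rational.Properties as ℚ
import Data.Rational.Unnormalised as ℚᵘ
import Data.Rational.Unnormalised.Properties as ℚᵘ
open import Data.Sum using (inj₁; inj₂)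
open import Data.Vec using (lookup; tabulate)
import Data.Vec as Vec
open import Data.Vec.Properties using (lookup∘tabulate; lookup-map)
open import Function using (_∘_)
open import Function.Bundles using (Equivalence)
open import Relation.Binary.PropositionalEquality
open import Relation.Nullary using (yes; no)

open Equivalence using (to; from)

reciprocal-bound : (α : ℚ) → 0ℚ < α →
  ∃ λ K → ∀ a b → α Q.* (+ a / 1) Q.≤ + b / 1 → a ≤ K * b
reciprocal-bound (Q.mkℚ (+ zero) q _) (Q.*<* 0<0) = ⊥-elim (ℤ.<-irrefl refl 0<0)
reciprocal-bound (Q.mkℚ ℤ.-[1+ _ ] q _) (Q.*<* ())
reciprocal-bound α@(Q.mkℚ (+ suc p) q _) _ = suc q , bound
  where
  +n/1 : ∀ a → + a / 1 ≡ Q.mkℚ (+ a) 0 (Coprime.sym (Coprime.1-coprimeTo a))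
  +n/1 a = ℚ.normalize-coprime (Coprime.sym (Coprime.1-coprimeTo a))

  -- With α = (p + 1)/(q + 1) in lowest terms, α·a ≤ b unfolds to (p + 1)·a ≤ (q + 1)·b.
  bound : ∀ a b → α Q.* (+ a / 1) Q.≤ + b / 1 → a ≤ suc q * b
  bound a b αa≤b
    with ℚᵘ.≤-respˡ-≃ (ℚ.toℚᵘ-homo-* α (+ a / 1)) (ℚ.toℚᵘ-mono-≤ αa≤b)
  ... | h rewrite +n/1 a | +n/1 b with h
  ... | ℚᵘ.*≤* pa≤qb =
    ≤-trans (m≤m+n a (p * a)) (subst (a + p * a ≤_) qb≡ (ℤ.drop‿+≤+ pa≤qb′))
    where
    pa≤qb′ : + (a + p * a) ℤ.≤ + (b * suc (q * 1))
    pa≤qb′ = subst₂ ℤ._≤_ (trans (ℤ.*-identityʳ _) (ℤ.+◃n≡+n _))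
                          (sym (ℤ.pos-* b (suc (q * 1)))) pa≤qb
    qb≡ : b * suc (q * 1) ≡ suc q * b
    qb≡ = trans (cong (λ z → b * suc z) (*-identityʳ q)) (*-comm b (suc q))

χ : Bool → ℕ
χ b = if b then 1 else 0

χ-mono : ∀ {b c} → (T b → T c) → χ b ≤ χ c
χ-mono {false} _ = z≤n
χ-mono {true} {true} _ = ≤-refl
χ-mono {true} {false} b⇒c = ⊥-elim (b⇒c _)

χ-not : ∀ {b} → T b → χ (not b) ≡ 0
χ-not {true} _ = refl

χ-split : ∀ b c → (T c → T b) → χ b ≡ χ (b ∧ not c) + χ c
χ-split true true _ = refl
χ-split true false _ = refl
χ-split false false _ = refl
χ-split false true c⇒b = ⊥-elim (c⇒b _)

not-mono : ∀ {a b} → (T a → T b) → T (not b) → T (not a)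
not-mono {false} _ _ = _
not-mono {true} {false} a⇒b _ = a⇒b _

∧-mapˡ : ∀ {a b c} → (T a → T c) → T (a ∧ b) → T (c ∧ b)
∧-mapˡ {true} {c = c} a⇒c b = from (T-∧ {c}) (a⇒c _ , b)

∧-mapʳ : ∀ {a b c} → (T b → T c) → T (a ∧ b) → T (a ∧ c)
∧-mapʳ {true} b⇒c = b⇒c

private variable
  A B : Set

sum-map-mono : ∀ {f g : A → ℕ} → (∀ x → f x ≤ g x) →
  ∀ xs → sum (map f xs) ≤ sum (map g xs)
sum-map-mono f≤g [] = z≤n
sum-map-mono f≤g (x ∷ xs) = +-mono-≤ (f≤g x) (sum-map-mono f≤g xs)

sum-map-0 : ∀ xs → sum (map (λ (_ : A) → 0) xs) ≡ 0
sum-map-0 [] = refl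
sum-map-0 (_ ∷ xs) = sum-map-0 xs

sum-map-+ : ∀ (f g : A → ℕ) xs →
  sum (map (λ x → f x + g x) xs) ≡ sum (map f xs) + sum (map g xs)
sum-map-+ f g [] = refl
sum-map-+ f g (x ∷ xs) =
  trans (cong (_+_ (f x + g x)) (sum-map-+ f g xs)) (interchange +-commutativeSemigroup (f x) (g x) _ _)

sum-map-*ˡ : ∀ k (f : A → ℕ) xs → sum (map (λ x → k * f x) xs) ≡ k * sum (map f xs)
sum-map-*ˡ k f [] = sym (*-zeroʳ k)
sum-map-*ˡ k f (x ∷ xs) =
  trans (cong (_+_ (k * f x)) (sum-map-*ˡ k f xs)) (sym (*-distribˡ-+ k (f x) _))

sum-map-swap : ∀ (f : A → B → ℕ) xs ys →
  sum (map (λ x → sum (map (f x) ys)) xs) ≡ sum (map (λ y → sum (map (λ x → f x y) xs)) ys)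
sum-map-swap f [] ys = sym (sum-map-0 ys)
sum-map-swap f (x ∷ xs) ys =
  trans (cong (_+_ (sum (map (f x) ys))) (sum-map-swap f xs ys)) (sym (sum-map-+ (f x) _ ys))

∑< : ℕ → (ℕ → ℕ) → ℕ
∑< zero g = 0
∑< (suc m) g = g 0 + ∑< m (g ∘ suc)

∑<-cong : ∀ m {g h : ℕ → ℕ} → (∀ i → g i ≡ h i) → ∑< m g ≡ ∑< m h
∑<-cong zero _ = refl
∑<-cong (suc m) g≡h = cong₂ _+_ (g≡h 0) (∑<-cong m (g≡h ∘ suc))

∑<-0 : ∀ m {g : ℕ → ℕ} → (∀ i → g i ≡ 0) → ∑< m g ≡ 0
∑<-0 zero _ = refl
∑<-0 (suc m) g≡0 = cong₂ _+_ (g≡0 0) (∑<-0 m (g≡0 ∘ suc))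

sum-map-∑< : ∀ m (g : ℕ → A → ℕ) xs →
  sum (map (λ x → ∑< m (λ j → g j x)) xs) ≡ ∑< m (λ j → sum (map (g j) xs))
sum-map-∑< zero g xs = sum-map-0 xs
sum-map-∑< (suc m) g xs =
  trans (sum-map-+ (g 0) _ xs) (cong (_+_ (sum (map (g 0) xs))) (sum-map-∑< m (g ∘ suc) xs))

∑<-geometric : ∀ K m (N : ℕ → ℕ) → (∀ j → suc K * N (suc j) ≤ K * N j) → ∑< m N ≤ suc K * N 0
∑<-geometric K zero N _ = z≤n
∑<-geometric K (suc m) N decay = begin
  N 0 + ∑< m (N ∘ suc)  ≤⟨ +-monoʳ-≤ (N 0) (∑<-geometric K m (N ∘ suc) (decay ∘ suc)) ⟩
  N 0 + suc K * N 1     ≤⟨ +-monoʳ-≤ (N 0) (decay 0) ⟩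
  N 0 + K * N 0         ∎
  where open ≤-Reasoning

search-≡-∑< : ∀ (P : ℕ → Bool) → (∀ k → T (P k) → T (P (suc k))) →
  ∀ f s → search P f s ≡ s + ∑< f (λ i → χ (not (P (i + s))))
search-≡-∑< P mono zero s = sym (+-identityʳ s)
search-≡-∑< P mono (suc f) s with P s in eq
... | true = sym (trans (cong (_+_ s) (∑<-0 f (χ-not ∘ holds ∘ suc))) (+-identityʳ s))
  where
  holds : ∀ i → T (P (i + s))
  holds zero = subst T (sym eq) _
  holds (suc i) = mono (i + s) (holds i)
... | false = begin
  search P f (suc s)                             ≡⟨ search-≡-∑< P mono f (suc s) ⟩
  suc s + ∑< f (λ i → χ (not (P (i + suc s))))  ≡⟨ cong (_+_ (suc s)) (∑<-cong f shift) ⟩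
  suc s + ∑< f (λ i → χ (not (P (suc i + s))))  ≡⟨ +-suc s _ ⟨
  s + suc (∑< f (λ i → χ (not (P (suc i + s)))))  ∎
  where
  open ≡-Reasoning
  shift : ∀ i → χ (not (P (i + suc s))) ≡ χ (not (P (suc i + s)))
  shift i = cong (χ ∘ not ∘ P) (+-suc i s)

module _ {n : ℕ} where

  count-mono : {P Q : Fin n → Bool} → (∀ x → T (P x) → T (Q x)) → count P ≤ count Q
  count-mono P⇒Q = sum-map-mono (λ x → χ-mono (P⇒Q x)) (allFin n)

  count-split : (P Q : Fin n → Bool) → (∀ x → T (Q x) → T (P x)) →
    count P ≡ count (λ x → P x ∧ not (Q x)) + count Q
  count-split P Q Q⇒P =
    trans (cong sum (map-cong (λ x → χ-split (P x) (Q x) (Q⇒P x)) (allFin n)))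
          (sum-map-+ _ _ (allFin n))

  any-allFin : (P : Fin n → Bool) (x : Fin n) → T (P x) → T (any P (allFin n))
  any-allFin P x = any⁺ P ∘ lose (∈-allFin x)

  any-mono : {P Q : Fin n → Bool} → (∀ x → T (P x) → T (Q x)) →
    T (any P (allFin n)) → T (any Q (allFin n))
  any-mono {P} {Q} P⇒Q = any⁺ Q ∘ Any.map (P⇒Q _) ∘ any⁻ P (allFin n)

sum-allFin-suc : ∀ {n} (f : Fin (suc n) → ℕ) →
  sum (map f (allFin (suc n))) ≡ f Fin.zero + sum (map (f ∘ Fin.suc) (allFin n))
sum-allFin-suc f =
  cong (_+_ (f Fin.zero)) (cong sum
    (trans (map-tabulate Fin.suc f) (sym (map-tabulate (λ x → x) (f ∘ Fin.suc)))))

∣p∣≡count-lookup : ∀ {n} (p : Subset n) → ∣ p ∣ ≡ count (lookup p)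
∣p∣≡count-lookup Vec.[] = refl
∣p∣≡count-lookup (true Vec.∷ p) =
  trans (cong suc (∣p∣≡count-lookup p)) (sym (sum-allFin-suc (χ ∘ lookup (true Vec.∷ p))))
∣p∣≡count-lookup (false Vec.∷ p) =
  trans (∣p∣≡count-lookup p) (sym (sum-allFin-suc (χ ∘ lookup (false Vec.∷ p))))

∣tabulate∣≡count : ∀ {n} (P : Fin n → Bool) → ∣ tabulate P ∣ ≡ count P
∣tabulate∣≡count {n} P =
  trans (∣p∣≡count-lookup (tabulate P))
        (cong sum (map-cong (cong χ ∘ lookup∘tabulate P) (allFin n)))

module _ {n : ℕ} (G : Graph n) where

  reach-suc : ∀ k {x y} → T (reach G k x y) → T (reach G (suc k) x y)
  reach-suc k = from T-∨ ∘ inj₁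

  reach-refl : ∀ k x → T (reach G k x x)
  reach-refl zero x with x ≟ x
  ... | yes _ = _
  ... | no x≢x = ⊥-elim (x≢x refl)
  reach-refl (suc k) x = reach-suc k (reach-refl k x)

  reach-adj : ∀ k {x y t} → T (adj G x y) → T (reach G k y t) → T (reach G (suc k) x t)
  reach-adj zero {x} {y} {t} xy _ with y ≟ t
  ... | yes refl = from T-∨ (inj₂ (any-allFin _ x (from T-∧ (reach-refl zero x , xy))))
  reach-adj (suc k) {x} {y} {t} xy yt with to T-∨ yt
  ... | inj₁ yt′ = reach-suc (suc k) (reach-adj k xy yt′)
  ... | inj₂ yzt = from T-∨ (inj₂ (any-mono (λ z → ∧-mapˡ {reach G k y z} (reach-adj k xy)) yzt))

  sum-count-adj : ∀ {d} → Regular d G → (P : Fin n → Bool) →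
    sum (map (λ x → count (λ y → P y ∧ adj G x y)) (allFin n)) ≡ d * count P
  sum-count-adj {d} regular P =
    trans (sum-map-swap (λ x y → χ (P y ∧ adj G x y)) (allFin n) (allFin n))
      (trans (cong sum (map-cong (λ y → column (P y) y) (allFin n)))
             (sum-map-*ˡ d (χ ∘ P) (allFin n)))
    where
    column : ∀ b y → sum (map (λ x → χ (b ∧ adj G x y)) (allFin n)) ≡ d * χ b
    column false y = trans (sum-map-0 (allFin n)) (sym (*-zeroʳ d))
    column true y =
      trans (cong sum (map-cong (λ x → cong χ (adj-sym G x y)) (allFin n)))
        (trans (regular y) (sym (*-identityʳ d)))

  edgeBoundary-≤ : ∀ {d} → Regular d G → (S : Subset n) (L : Fin n → Bool) →
    (∀ {x y} → T (lookup S x) → T (not (lookup S y)) → T (adj G x y) → T (L y)) →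
    edgeBoundary G S ≤ d * count L
  edgeBoundary-≤ regular S L exits-into-L =
    ≤-trans (sum-map-mono row (allFin n)) (≤-reflexive (sum-count-adj regular L))
    where
    row : ∀ x → (if lookup S x then count (λ y → not (lookup S y) ∧ adj G x y) else 0)
              ≤ count (λ y → L y ∧ adj G x y)
    row x with lookup S x in x∈S
    ... | false = z≤n
    ... | true = count-mono (λ y y∉S∧xy →
      let y∉S , xy = to (T-∧ {not (lookup S y)}) y∉S∧xy
      in from (T-∧ {L y}) (exits-into-L (subst T (sym x∈S) _) y∉S xy , xy))

module Layers {n : ℕ} (G : Graph n) (U : Subset n) where

  -- T (near k x) iff d_G(x, M ∖ U) ≤ k; distToSet G x (∁ U) searches for the least such k.
  near : ℕ → Fin n → Bool
  near k x = any (λ y → lookup (∁ U) y ∧ reach G k x y) (allFin n)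

  far : ℕ → Fin n → Bool
  far k x = not (near k x)

  near-suc : ∀ k {x} → T (near k x) → T (near (suc k) x)
  near-suc k = any-mono (λ y → ∧-mapʳ {lookup (∁ U) y} (reach-suc G k))

  near-adj : ∀ k {x y} → T (adj G x y) → T (near k y) → T (near (suc k) x)
  near-adj k xy = any-mono (λ t → ∧-mapʳ {lookup (∁ U) t} (reach-adj G k xy))

  ∉⇒near : ∀ k {x} → T (not (lookup U x)) → T (near k x)
  ∉⇒near k {x} x∉U = any-allFin _ x (from (T-∧ {lookup (∁ U) x})
    (subst T (sym (lookup-map x not U)) x∉U , reach-refl G k x))

  far⇒∈ : ∀ k {x} → T (far k x) → T (lookup U x)
  far⇒∈ k {x} x-far with lookup U x in x∈U
  ... | true = _
  ... | false = subst (T ∘ not ∘ not) x∈U (not-mono (∉⇒near k) x-far)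

  distance-as-∑< : ∀ x →
    (if lookup U x then distToSet G x (∁ U) else 0) ≡ ∑< n (λ j → χ (far j x))
  distance-as-∑< x with lookup U x in x∈U
  ... | true = trans (search-≡-∑< (λ k → near k x) (λ k → near-suc k) n 0)
                     (∑<-cong n (λ j → cong (λ k → χ (far k x)) (+-identityʳ j)))
  ... | false = sym (∑<-0 n (λ j → χ-not (∉⇒near j (subst (T ∘ not) (sym x∈U) _))))

  sumOver-distance≡∑<-count-far :
    sumOver U (λ x → distToSet G x (∁ U)) ≡ ∑< n (λ j → count (far j))
  sumOver-distance≡∑<-count-far =
    trans (cong sum (map-cong distance-as-∑< (allFin n)))
          (sum-map-∑< n (λ j → χ ∘ far j) (allFin n))

  count-far≤∣U∣ : ∀ k → count (far k) ≤ ∣ U ∣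
  count-far≤∣U∣ k =
    ≤-trans (count-mono {P = far k} (λ _ → far⇒∈ k)) (≤-reflexive (sym (∣p∣≡count-lookup U)))

  count-far-decay : ∀ {d} .{{_ : NonZero d}} → Regular d G → ∀ K →
    (∀ S → 2 * ∣ S ∣ ≤ n → d * ∣ S ∣ ≤ K * edgeBoundary G S) → 2 * ∣ U ∣ ≤ n →
    ∀ j → suc K * count (far (suc j)) ≤ K * count (far j)
  count-far-decay {d} regular K expand 2∣U∣≤n j = begin
    count F + K * count F          ≤⟨ +-monoˡ-≤ (K * count F) F≤K*shell ⟩
    K * count shell + K * count F  ≡⟨ *-distribˡ-+ K (count shell) (count F) ⟨
    K * (count shell + count F)    ≡⟨ cong (K *_) (count-split (far j) F (λ _ → far-suc)) ⟨
    K * count (far j)              ∎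
    where
    open ≤-Reasoning
    F : Fin n → Bool
    F = far (suc j)
    shell : Fin n → Bool
    shell y = far j y ∧ not (F y)

    far-suc : ∀ {x} → T (F x) → T (far j x)
    far-suc = not-mono (near-suc j)

    edges-leave-into-shell : ∀ {x y} → T (lookup (tabulate F) x) →
      T (not (lookup (tabulate F) y)) → T (adj G x y) → T (shell y)
    edges-leave-into-shell {x} {y} x∈F y∉F xy = from (T-∧ {far j y})
      ( not-mono (near-adj j xy) (subst T (lookup∘tabulate F x) x∈F)
      , subst (T ∘ not) (lookup∘tabulate F y) y∉F )

    ∣F∣≡count-F : ∣ tabulate F ∣ ≡ count F
    ∣F∣≡count-F = ∣tabulate∣≡count F

    F-small : 2 * ∣ tabulate F ∣ ≤ n
    F-small = ≤-trans (*-monoʳ-≤ 2 (≤-trans (≤-reflexive ∣F∣≡count-F) (count-far≤∣U∣ (suc j))))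
                      2∣U∣≤n

    F≤K*shell : count F ≤ K * count shell
    F≤K*shell = *-cancelˡ-≤ d (begin
      d * count F                ≡⟨ cong (d *_) ∣F∣≡count-F ⟨
      d * ∣ tabulate F ∣         ≤⟨ expand (tabulate F) F-small ⟩
      K * edgeBoundary G (tabulate F)
        ≤⟨ *-monoʳ-≤ K (edgeBoundary-≤ G regular (tabulate F) shell edges-leave-into-shell) ⟩
      K * (d * count shell)      ≡⟨ x∙yz≈y∙xz *-commutativeSemigroup K d (count shell) ⟩
      d * (K * count shell)      ∎)

sumOver-distance-≤ : ∀ {n d} .{{_ : NonZero d}} (G : Graph n) → Regular d G → ∀ K →
  (∀ S → 2 * ∣ S ∣ ≤ n → d * ∣ S ∣ ≤ K * edgeBoundary G S) →
  ∀ U → 2 * ∣ U ∣ ≤ n → sumOver U (λ x → distToSet G x (∁ U)) ≤ suc K * ∣ U ∣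
sumOver-distance-≤ {n} G regular K expand U 2∣U∣≤n = begin
  sumOver U (λ x → distToSet G x (∁ U))  ≡⟨ sumOver-distance≡∑<-count-far ⟩
  ∑< n (λ j → count (far j))             ≤⟨ ∑<-geometric K n _ decay ⟩
  suc K * count (far 0)                  ≤⟨ *-monoʳ-≤ (suc K) (count-far≤∣U∣ 0) ⟩
  suc K * ∣ U ∣                          ∎
  where
  open ≤-Reasoning
  open Layers G U
  decay : ∀ j → suc K * count (far (suc j)) ≤ K * count (far j)
  decay = count-far-decay regular K expand 2∣U∣≤n

lemma25 : (α : ℚ) → 0ℚ < α → α < 1ℚ →
    Σ ℕ λ c →
      (d : ℕ) → .{{_ : NonZero d}} → (n : ℕ) → (G : Graph n) → Regular d G →
      ((S : Subset n) → 2 * ∣ S ∣ ≤ n →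
        α Q.* ((+ (d * ∣ S ∣)) / 1) Q.≤ ((+ edgeBoundary G S) / 1)) →
      (U : Subset n) → Nonempty U → 2 * ∣ U ∣ ≤ n →
      sumOver U (λ x → distToSet G x (∁ U)) ≤ c * ∣ U ∣
lemma25 α 0<α _ with reciprocal-bound α 0<α
... | K , bound = suc K , λ d n G regular expansion U _ →
  sumOver-distance-≤ G regular K (λ S small → bound _ _ (expansion S small)) U
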